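{- Let $N$ be a positive integer. If there exists one pair of palindromic numbers $A, B$ with $N = A/B$, then there are infinitely many such pairs.
   Context: A palindromic number is a positive integer whose base-$2$ representation (written without leading zeros) reads the same forwards and backwards. -}

module Defs where

open import Data.Nat using (ℕ; zero; suc; _*_; _<_)
open import Data.Nat.Induction using (<-wellFounded)
open import Data.Nat.DivMod using (_/_; _%_; m/n<m)
open import Data.Nat.Properties using (≤-refl)
open import Data.List using (List; []; _∷_; reverse)
open import Data.Product using (_×_; _,_)
open import Relation.Binary.PropositionalEquality using (_≡_)
open import Induction.WellFounded using (Acc; acc)

-- Binary digits of n, least significant first, without leading zeros
-- (binDigits 0 = []).
binDigits-acc : (n : ℕ) → Acc _<_ n → List ℕ
binDigits-acc zero _ = []
binDigits-acc (suc n) (acc rs) =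
  (suc n % 2) ∷ binDigits-acc (suc n / 2) (rs (m/n<m (suc n) 2 (Data.Nat.s≤s (Data.Nat.s≤s Data.Nat.z≤n))))
  where import Data.Nat

binDigits : ℕ → List ℕ
binDigits n = binDigits-acc n (<-wellFounded n)

Palindromic : ℕ → Set
Palindromic n = (0 < n) × (reverse (binDigits n) ≡ binDigits n)

GoodPair : ℕ → ℕ × ℕ → Set
GoodPair N (A , B) = Palindromic A × Palindromic B × (A ≡ N * B)

-- If the binary word w of n is a palindrome and k ≥ |w|, then the binary word of
-- n (1 + 2^k) is w 0^(k - |w|) w, again a palindrome. Multiplying both A = N B and B
-- by 1 + 2^k therefore gives a new pair with the same ratio N, and since k can be
-- taken arbitrarily large, B (1 + 2^k) escapes any finite list of pairs.
module Submission where

open import Defs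
open import Data.Nat using (ℕ; _<_)
open import Data.Product using (_×_; _,_; ∃)
open import Data.List using (List)
open import Data.List.Membership.Propositional using (_∈_)
open import Relation.Nullary using (¬_)

open import Data.Nat using (zero; suc; _+_; _*_; _^_; _≤_; z≤n; s≤s; >-nonZero)
open import Data.Nat.Properties
open import Data.Nat.DivMod
open import Data.Nat.Induction using (<-wellFounded; <-rec)
open import Induction.WellFounded using (Acc; acc)
open import Data.List using ([]; _∷_; _++_; _∷ʳ_; reverse; replicate; length; map)
open import Data.List.Properties using (reverse-++; unfold-reverse; ++-assoc; ++-conicalʳ; length-replicate)
open import Data.List.Relation.Unary.All as All using (All; []; _∷_)
open import Data.List.Relation.Unary.All.Properties using (replicate⁺)
open import Data.List.Membership.Propositional.Properties using (∈-map⁺)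
open import Data.List.Extrema.Nat using (max; xs≤max)
open import Data.Product using (proj₁; proj₂)
open import Relation.Binary.PropositionalEquality
open import Relation.Nullary using (contradiction)
open import Data.Nat.Tactic.RingSolver using (solve-∀)

binDigits-acc-irrelevant : ∀ n (a b : Acc _<_ n) → binDigits-acc n a ≡ binDigits-acc n b
binDigits-acc-irrelevant zero _ _ = refl
binDigits-acc-irrelevant (suc n) (acc rs) (acc rs') =
  cong (_ ∷_) (binDigits-acc-irrelevant _ (rs _) (rs' _))

half<self : ∀ n → suc n / 2 < suc n
half<self n = m/n<m (suc n) 2 (s≤s (s≤s z≤n))

binDigits-suc : ∀ n → binDigits (suc n) ≡ suc n % 2 ∷ binDigits (suc n / 2)
binDigits-suc n with <-wellFounded (suc n)
... | acc rs = cong (suc n % 2 ∷_) (binDigits-acc-irrelevant _ _ _)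

binDigits≡[]⇒≡0 : ∀ {n} → binDigits n ≡ [] → n ≡ 0
binDigits≡[]⇒≡0 {zero}  _  = refl
binDigits≡[]⇒≡0 {suc n} eq with () ← trans (sym (binDigits-suc n)) eq

fromBits : List ℕ → ℕ
fromBits []       = 0
fromBits (d ∷ ds) = d + fromBits ds * 2

data Canonical : List ℕ → Set where
  []  : Canonical []
  bit : ∀ {d ds} → d < 2 → (ds ≡ [] → d ≡ 1) → Canonical ds → Canonical (d ∷ ds)

Canonical⇒bits : ∀ {ds} → Canonical ds → All (_< 2) ds
Canonical⇒bits []            = []
Canonical⇒bits (bit d<2 _ c) = d<2 ∷ Canonical⇒bits c

fromBits-binDigits : ∀ n → fromBits (binDigits n) ≡ n
fromBits-binDigits = <-rec _ step
  where
  open ≡-Reasoning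
  step : ∀ n → (∀ {m} → m < n → fromBits (binDigits m) ≡ m) → fromBits (binDigits n) ≡ n
  step zero    _  = refl
  step (suc n) ih = begin
    fromBits (binDigits (suc n))                      ≡⟨ cong fromBits (binDigits-suc n) ⟩
    suc n % 2 + fromBits (binDigits (suc n / 2)) * 2  ≡⟨ cong (λ h → suc n % 2 + h * 2) (ih (half<self n)) ⟩
    suc n % 2 + suc n / 2 * 2                         ≡⟨ m≡m%n+[m/n]*n (suc n) 2 ⟨
    suc n                                             ∎

binDigits-canonical : ∀ n → Canonical (binDigits n)
binDigits-canonical = <-rec _ step
  where
  leading : ∀ n → binDigits (suc n / 2) ≡ [] → suc n % 2 ≡ 1
  leading n eq with m/n≡0⇒m<n {suc n} {2} (binDigits≡[]⇒≡0 eq)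
  ... | s≤s (s≤s z≤n) = refl
  step : ∀ n → (∀ {m} → m < n → Canonical (binDigits m)) → Canonical (binDigits n)
  step zero    _  = []
  step (suc n) ih rewrite binDigits-suc n = bit (m%n<n (suc n) 2) (leading n) (ih (half<self n))

fromBits-pos : ∀ {d ds} → Canonical (d ∷ ds) → 0 < fromBits (d ∷ ds)
fromBits-pos {ds = []}    (bit _ leading _) rewrite leading refl = s≤s z≤n
fromBits-pos {ds = _ ∷ _} (bit _ _ c) =
  ≤-trans (≤-trans (fromBits-pos c) (m≤m*n _ 2)) (m≤n+m _ _)

[d+e*2]%2≡d : ∀ {d} e → d < 2 → (d + e * 2) % 2 ≡ d
[d+e*2]%2≡d {d} e d<2 = trans ([m+kn]%n≡m%n d e 2) (m<n⇒m%n≡m d<2)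

[d+e*2]/2≡e : ∀ {d} e → d < 2 → (d + e * 2) / 2 ≡ e
[d+e*2]/2≡e {d} e d<2 = *-cancelʳ-≡ _ e 2 (+-cancelˡ-≡ d _ _ (begin
  d + (d + e * 2) / 2 * 2                ≡⟨ cong (_+ (d + e * 2) / 2 * 2) ([d+e*2]%2≡d e d<2) ⟨
  (d + e * 2) % 2 + (d + e * 2) / 2 * 2  ≡⟨ m≡m%n+[m/n]*n (d + e * 2) 2 ⟨
  d + e * 2                              ∎))
  where open ≡-Reasoning

binDigits-fromBits : ∀ {ds} → Canonical ds → binDigits (fromBits ds) ≡ ds
binDigits-fromBits [] = refl
binDigits-fromBits {d ∷ ds} c@(bit d<2 _ c′) with fromBits (d ∷ ds) in eq | fromBits-pos c
... | suc n | _ = begin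
  binDigits (suc n)                    ≡⟨ binDigits-suc n ⟩
  suc n % 2 ∷ binDigits (suc n / 2)    ≡⟨ cong (λ m → m % 2 ∷ binDigits (m / 2)) eq ⟨
  (d + fromBits ds * 2) % 2 ∷ binDigits ((d + fromBits ds * 2) / 2)
    ≡⟨ cong₂ (λ x y → x ∷ binDigits y) ([d+e*2]%2≡d (fromBits ds) d<2) ([d+e*2]/2≡e (fromBits ds) d<2) ⟩
  d ∷ binDigits (fromBits ds)          ≡⟨ cong (d ∷_) (binDigits-fromBits c′) ⟩
  d ∷ ds                               ∎
  where open ≡-Reasoning

fromBits-++ : ∀ xs ys → fromBits (xs ++ ys) ≡ fromBits xs + fromBits ys * 2 ^ length xs
fromBits-++ []       ys = sym (*-identityʳ (fromBits ys))
fromBits-++ (x ∷ xs) ys rewrite fromBits-++ xs ys = shift x (fromBits xs) (fromBits ys) (2 ^ length xs)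
  where
  shift : ∀ x a b p → x + (a + b * p) * 2 ≡ x + a * 2 + b * (2 * p)
  shift = solve-∀

fromBits-zeros : ∀ m → fromBits (replicate m 0) ≡ 0
fromBits-zeros zero = refl
fromBits-zeros (suc m) rewrite fromBits-zeros m = refl

canonical-++ : ∀ {xs ys} → All (_< 2) xs → Canonical ys → ys ≢ [] → Canonical (xs ++ ys)
canonical-++ []                     c ys≢[] = c
canonical-++ {x ∷ xs} (x<2 ∷ bits) c ys≢[] =
  bit x<2 (λ eq → contradiction (++-conicalʳ xs _ eq) ys≢[]) (canonical-++ bits c ys≢[])

replicate-∷ʳ : ∀ {a} {A : Set a} m (x : A) → replicate m x ∷ʳ x ≡ x ∷ replicate m x
replicate-∷ʳ zero    x = refl
replicate-∷ʳ (suc m) x = cong (x ∷_) (replicate-∷ʳ m x)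

reverse-replicate : ∀ {a} {A : Set a} m (x : A) → reverse (replicate m x) ≡ replicate m x
reverse-replicate zero    x = refl
reverse-replicate (suc m) x = begin
  reverse (x ∷ replicate m x)  ≡⟨ unfold-reverse x (replicate m x) ⟩
  reverse (replicate m x) ∷ʳ x ≡⟨ cong (_∷ʳ x) (reverse-replicate m x) ⟩
  replicate m x ∷ʳ x           ≡⟨ replicate-∷ʳ m x ⟩
  x ∷ replicate m x            ∎
  where open ≡-Reasoning

reverse-sandwich : ∀ {a} {A : Set a} {xs ys : List A} → reverse xs ≡ xs → reverse ys ≡ ys →
                   reverse (xs ++ ys ++ xs) ≡ xs ++ ys ++ xs
reverse-sandwich {xs = xs} {ys} rev-xs rev-ys = begin
  reverse (xs ++ ys ++ xs)                     ≡⟨ reverse-++ xs (ys ++ xs) ⟩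
  reverse (ys ++ xs) ++ reverse xs             ≡⟨ cong (_++ reverse xs) (reverse-++ ys xs) ⟩
  (reverse xs ++ reverse ys) ++ reverse xs     ≡⟨ ++-assoc (reverse xs) (reverse ys) (reverse xs) ⟩
  reverse xs ++ reverse ys ++ reverse xs       ≡⟨ cong₂ (λ u v → u ++ v ++ u) rev-xs rev-ys ⟩
  xs ++ ys ++ xs                               ∎
  where open ≡-Reasoning

binDigits-*-1+2^ : ∀ {n} m → 0 < n →
  binDigits (n * (1 + 2 ^ (length (binDigits n) + m))) ≡ binDigits n ++ replicate m 0 ++ binDigits n
binDigits-*-1+2^ {n} m 0<n = begin
  binDigits (n * (1 + 2 ^ (ℓ + m)))  ≡⟨ cong binDigits value ⟨
  binDigits (fromBits (bs ++ zs ++ bs)) ≡⟨ binDigits-fromBits canonical ⟩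
  bs ++ zs ++ bs                        ∎
  where
  open ≡-Reasoning
  bs = binDigits n
  zs = replicate m 0
  ℓ = length bs
  bs≢[] : bs ≢ []
  bs≢[] eq = contradiction (binDigits≡[]⇒≡0 eq) (>⇒≢ 0<n)
  canonical : Canonical (bs ++ zs ++ bs)
  canonical = canonical-++ (Canonical⇒bits (binDigits-canonical n))
    (canonical-++ (replicate⁺ m (s≤s z≤n)) (binDigits-canonical n) bs≢[])
    (λ eq → bs≢[] (++-conicalʳ zs bs eq))
  value : fromBits (bs ++ zs ++ bs) ≡ n * (1 + 2 ^ (ℓ + m))
  value = begin
    fromBits (bs ++ zs ++ bs)                                   ≡⟨ fromBits-++ bs (zs ++ bs) ⟩
    fromBits bs + fromBits (zs ++ bs) * 2 ^ ℓ                   ≡⟨ cong (λ v → fromBits bs + v * 2 ^ ℓ) (fromBits-++ zs bs) ⟩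
    fromBits bs + (fromBits zs + fromBits bs * 2 ^ length zs) * 2 ^ ℓ
      ≡⟨ cong₂ (λ a z → a + (z + a * 2 ^ length zs) * 2 ^ ℓ) (fromBits-binDigits n) (fromBits-zeros m) ⟩
    n + n * 2 ^ length zs * 2 ^ ℓ                                ≡⟨ cong (λ l → n + n * 2 ^ l * 2 ^ ℓ) (length-replicate m) ⟩
    n + n * 2 ^ m * 2 ^ ℓ                                        ≡⟨ rearrange n (2 ^ m) (2 ^ ℓ) ⟩
    n * (1 + 2 ^ ℓ * 2 ^ m)                                      ≡⟨ cong (λ p → n * (1 + p)) (^-distribˡ-+-* 2 ℓ m) ⟨
    n * (1 + 2 ^ (ℓ + m))                                        ∎
    where
    rearrange : ∀ a p q → a + a * p * q ≡ a * (1 + q * p)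
    rearrange = solve-∀

palindromic-*-1+2^ : ∀ {n} k → Palindromic n → length (binDigits n) ≤ k → Palindromic (n * (1 + 2 ^ k))
palindromic-*-1+2^ {n} k (0<n , rev) ℓ≤k with m , refl ← m≤n⇒∃[o]m+o≡n ℓ≤k =
  ≤-trans 0<n (m≤m*n n (1 + 2 ^ k)) ,
  subst (λ ds → reverse ds ≡ ds) (sym (binDigits-*-1+2^ m 0<n))
        (reverse-sandwich rev (reverse-replicate m 0))

n<2^n : ∀ n → n < 2 ^ n
n<2^n zero    = s≤s z≤n
n<2^n (suc n) = +-mono-≤ (m^n>0 2 n) (≤-trans (n<2^n n) (m≤m+n (2 ^ n) 0))

n<m*[1+2^n] : ∀ {m} n → 0 < m → n < m * (1 + 2 ^ n)
n<m*[1+2^n] {m} n 0<m = begin-strict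
  n                  <⟨ n<2^n n ⟩
  2 ^ n              <⟨ n<1+n (2 ^ n) ⟩
  1 + 2 ^ n          ≤⟨ m≤n*m (1 + 2 ^ n) m {{>-nonZero 0<m}} ⟩
  m * (1 + 2 ^ n)    ∎
  where open ≤-Reasoning

theorem11 : (N : ℕ) → 0 < N → ∃ (λ p → GoodPair N p) →
    (ps : List (ℕ × ℕ)) → ∃ (λ p → GoodPair N p × ¬ (p ∈ ps))
theorem11 N _ ((A , B) , palA , palB , A≡NB) ps =
  (A * c , B * c) ,
  (palindromic-*-1+2^ k palA ℓA≤k , palindromic-*-1+2^ k palB ℓB≤k , ratio) , fresh
  where
  ℓA = length (binDigits A)
  ℓB = length (binDigits B)
  bound = max 0 (map proj₂ ps)
  k = ℓA + ℓB + bound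
  c = 1 + 2 ^ k
  ℓA≤k : ℓA ≤ k
  ℓA≤k = ≤-trans (m≤m+n ℓA ℓB) (m≤m+n (ℓA + ℓB) bound)
  ℓB≤k : ℓB ≤ k
  ℓB≤k = ≤-trans (m≤n+m ℓB ℓA) (m≤m+n (ℓA + ℓB) bound)
  ratio : A * c ≡ N * (B * c)
  ratio = trans (cong (_* c) A≡NB) (*-assoc N B c)
  fresh : ¬ ((A * c , B * c) ∈ ps)
  fresh p∈ps = <⇒≱ (≤-<-trans (m≤n+m bound (ℓA + ℓB)) (n<m*[1+2^n] k (proj₁ palB)))
                   (All.lookup (xs≤max 0 (map proj₂ ps)) (∈-map⁺ proj₂ p∈ps))
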